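{- Let $n$ be an even positive integer and let $\vec P_n$ be an alternating path on $n$ vertices. Then $\operatorname{th}(\vec P_n)=\frac n2+\left\lceil\sqrt{n+1}-1\right\rceil$.
   Context: An alternating path on $n$ vertices is an orientation of the path $P_n$ (each edge replaced by exactly one of its two arcs) in which every vertex is either a source (in-degree $0$) or a sink (out-degree $0$). Zero forcing on a digraph: vertices are blue or white; a blue vertex $u$ with exactly one white out-neighbor $w$ may force $w$ ($u\to w$), turning it blue. A set $\mathcal F$ of forces is a set of forces of $B\subseteq V$ if, starting with exactly $B$ blue, the forces in $\mathcal F$ can be validly performed in some order after which no further force is possible. Put $\mathcal F^{[0]}=B$ and $\mathcal F^{[t+1]}=\mathcal F^{[t]}\cup\{w\notin\mathcal F^{[t]}:(u\to w)\in\mathcal F,\ u\in\mathcal F^{[t]},\ w$ the only out-neighbor of $u$ outside $\mathcal F^{[t]}\}$; $\operatorname{pt}(\Gamma;\mathcal F)$ is the least $t$ with $\mathcal F^{[t]}=V$ ($\infty$ if none); $\operatorname{pt}(\Gamma;B)=\min_{\mathcal F}\operatorname{pt}(\Gamma;\mathcal F)$. The throttling number is $\operatorname{th}(\Gamma)=\min_{B\subseteq V}(|B|+\operatorname{pt}(\Gamma;B))$. -}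

module Defs where

open import Data.Nat using (ℕ; zero; suc; _+_; _*_; _≤_)
open import Data.Bool using (Bool; true; false)
open import Data.Fin using (Fin; toℕ)
open import Data.Fin.Subset using (Subset; ∣_∣) renaming (_∈_ to _∈ₛ_)
open import Data.List using (List; []; _∷_)
open import Data.List.Membership.Propositional using (_∈_)
open import Data.Product using (Σ; ∃; _×_; _,_)
open import Data.Sum using (_⊎_)
open import Relation.Nullary using (¬_)
open import Relation.Binary.PropositionalEquality using (_≡_)

Digraph : ℕ → Set₁
Digraph n = Fin n → Fin n → Set

VSet : ℕ → Set₁
VSet n = Fin n → Set

module _ {n : ℕ} (Γ : Digraph n) where

  CanForce : VSet n → Fin n → Fin n → Set
  CanForce S u w = S u × ¬ S w × Γ u w × (∀ v → Γ u v → ¬ S v → v ≡ w)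

  Terminal : VSet n → Set
  Terminal S = ∀ u w → ¬ CanForce S u w

  ValidFrom : VSet n → List (Fin n × Fin n) → Set
  ValidFrom S [] = Terminal S
  ValidFrom S ((u , w) ∷ ℓ) = CanForce S u w × ValidFrom (λ x → S x ⊎ x ≡ w) ℓ

  -- The set F of forces (the elements of ℓ) is a set of forces of B:
  -- ℓ is an order in which the forces of F can be validly performed.
  IsForceOrderOf : Subset n → List (Fin n × Fin n) → Set
  IsForceOrderOf B ℓ = ValidFrom (λ x → x ∈ₛ B) ℓ

  Stage : Subset n → List (Fin n × Fin n) → ℕ → VSet n
  Stage B ℓ zero w = w ∈ₛ B
  Stage B ℓ (suc t) w =
    Stage B ℓ t w ⊎
    (¬ Stage B ℓ t w ×
     Σ (Fin n) λ u → ((u , w) ∈ ℓ) × Stage B ℓ t u × Γ u w ×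
       (∀ v → Γ u v → ¬ Stage B ℓ t v → v ≡ w))

  AllBlueAt : Subset n → List (Fin n × Fin n) → ℕ → Set
  AllBlueAt B ℓ t = ∀ v → Stage B ℓ t v

  -- th(Γ) = k, i.e. k = min_B (|B| + min_F pt(Γ;F)):
  -- k is attained, and every B, every set of forces F of B and every t with
  -- F^{[t]} = V satisfy k ≤ |B| + t.
  ThrottlingNumberIs : ℕ → Set
  ThrottlingNumberIs k =
    (Σ (Subset n) λ B → Σ (List (Fin n × Fin n)) λ ℓ → Σ ℕ λ t →
       IsForceOrderOf B ℓ × AllBlueAt B ℓ t × ∣ B ∣ + t ≡ k)
    × (∀ (B : Subset n) (ℓ : List (Fin n × Fin n)) (t : ℕ) →
         IsForceOrderOf B ℓ → AllBlueAt B ℓ t → k ≤ ∣ B ∣ + t)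

-- An orientation of the path P_n with vertices 0,…,n-1 and edges {i,i+1}:
-- d i = true means the edge {i,i+1} is oriented i → i+1, false means i+1 → i.
-- (Values d i for i ≥ n-1 are irrelevant.)
PathOrientation : (n : ℕ) → (ℕ → Bool) → Digraph n
PathOrientation n d u v =
  (toℕ v ≡ suc (toℕ u) × d (toℕ u) ≡ true) ⊎
  (toℕ u ≡ suc (toℕ v) × d (toℕ v) ≡ false)

IsSource IsSink : {n : ℕ} → Digraph n → Fin n → Set
IsSource Γ v = ∀ u → ¬ Γ u v
IsSink Γ v = ∀ w → ¬ Γ v w

Alternating : {n : ℕ} → Digraph n → Set
Alternating {n} Γ = ∀ (v : Fin n) → IsSource Γ v ⊎ IsSink Γ v

-- k = ⌈√(n+1) − 1⌉, i.e. k is the least natural number with n+1 ≤ (k+1)².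
IsCeilSqrtSucMinusOne : ℕ → ℕ → Set
IsCeilSqrtSucMinusOne n k =
  (suc n ≤ suc k * suc k) × (∀ j → suc n ≤ suc j * suc j → k ≤ j)

-- Up to reversing the path, an alternating path on 2m vertices is
-- the canonical one Γc whose sources are the even positions 2j and whose
-- sinks are the odd positions 2j+1 ("sink j").  Sources have no in-arcs,
-- so they are never forced and every zero forcing set contains all m of
-- them.  Sink j can only be forced along a chain of sinks
-- j, j±1, j±2, … that starts at an initially blue sink or, moving right,
-- at the left end of the path; in t steps a chain covers at most t sinks
-- on each side of a blue sink.  Hence b blue sinks and propagation time t
-- need m ≤ t + (2t+1)·b, which forces 2m+1 ≤ (b+t+1)², i.e. k ≤ b+t
-- (lower bound).  Conversely, for k = b+t with b ∈ {t, t+1} the sinks are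
-- split into blocks of 2t+1 around b seed sinks, read from the right end,
-- and the resulting explicit force order finishes in time t (upper bound).
module Submission where

open import Defs
open import Data.Nat using (ℕ; zero; suc; _+_; _*_; _<_; _≤_; _∸_; z≤n; s≤s; _≟_; _≤?_; _<?_)
open import Data.Nat.Properties
open import Data.Nat.Induction using (<-rec)
open import Data.Nat.DivMod using (_%_; _/_; m%n<n; m<n⇒m%n≡m; n%n≡0; [m+kn]%n≡m%n; [m+n]%n≡m%n; m≡m%n+[m/n]*n)
open import Data.Bool using (Bool; true; false; not; _xor_) renaming (_≟_ to _≟ᵇ_)
open import Data.Bool.Properties using (not-distribˡ-xor; not-injective)
open import Data.Fin using (Fin; toℕ; fromℕ<; opposite) renaming (zero to fz; suc to fs)
import Data.Fin.Properties as Finₚ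
open import Data.Fin.Subset using (Subset; ∣_∣) renaming (_∈_ to _∈ₛ_)
open import Data.Fin.Subset.Properties using (_∈?_)
open import Data.Vec using ([]; _∷_; lookup; tabulate)
open import Data.Vec.Properties using (lookup⇒[]=; []=⇒lookup; lookup∘tabulate; tabulate-cong; tabulate∘lookup)
open import Data.List using (List; []; _∷_; map; _++_)
open import Data.List.Membership.Propositional using (_∈_)
open import Data.List.Membership.Propositional.Properties using (∈-map⁺; ∈-map⁻; ∈-++⁺ˡ; ∈-++⁺ʳ)
import Data.List.Membership.DecPropositional as DecMembership
open import Data.List.Relation.Unary.Any using (here; there)
open import Data.Product using (Σ; _×_; _,_; proj₁; proj₂; uncurry)
open import Data.Product.Properties using (≡-dec)
open import Data.Sum using (_⊎_; inj₁; inj₂; [_,_]′)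
open import Data.Empty using (⊥; ⊥-elim)
open import Function.Bundles using (_⇔_; mk⇔; Equivalence)
open import Relation.Nullary using (¬_; Dec; yes; no)
open import Relation.Nullary.Decidable using (_×-dec_; _⊎-dec_; _→-dec_; ¬?)
open import Relation.Binary.Definitions using (tri<; tri≈; tri>)
open import Relation.Binary.PropositionalEquality using (_≡_; refl; sym; trans; cong; cong₂; subst; _≢_; module ≡-Reasoning)
open import Data.Nat.Solver using (module +-*-Solver)
open +-*-Solver using (solve; _:+_; _:*_; _:=_; con)

open Equivalence using (to; from)

-- 1. Forcing in an arbitrary digraph

module Forcing {n : ℕ} (Γ : Digraph n) (Γ? : ∀ u v → Dec (Γ u v)) where

  open DecMembership (≡-dec (Finₚ._≟_ {n}) (Finₚ._≟_ {n})) using () renaming (_∈?_ to _∈ℓ?_)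

  stage? : ∀ B ℓ t w → Dec (Stage Γ B ℓ t w)
  stage? B ℓ zero w = w ∈? B
  stage? B ℓ (suc t) w with stage? B ℓ t w
  ... | yes s = yes (inj₁ s)
  ... | no ¬s with Finₚ.any? (λ u → ((u , w) ∈ℓ? ℓ) ×-dec stage? B ℓ t u ×-dec Γ? u w ×-dec
                     Finₚ.all? (λ v → Γ? u v →-dec ¬? (stage? B ℓ t v) →-dec (v Finₚ.≟ w)))
  ... | yes (u , p) = yes (inj₂ (¬s , u , p))
  ... | no ¬p = no λ { (inj₁ s) → ¬s s ; (inj₂ (_ , u , p)) → ¬p (u , p) }

  stage-mono : ∀ {B ℓ s s' w} → s ≤ s' → Stage Γ B ℓ s w → Stage Γ B ℓ s' w
  stage-mono {B} {ℓ} {s} {s'} {w} s≤s' st = subst (λ z → Stage Γ B ℓ z w) (m∸n+n≡m s≤s') (later (s' ∸ s))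
    where
    later : ∀ d → Stage Γ B ℓ (d + s) w
    later zero = st
    later (suc d) = inj₁ (later d)

  only-white : ∀ {S : VSet n} {u w} → (∀ v → Γ u v → toℕ v ≢ toℕ w → S v) → ∀ v → Γ u v → ¬ S v → v ≡ w
  only-white {w = w} others v uv ¬sv with toℕ v ≟ toℕ w
  ... | yes e = Finₚ.toℕ-injective e
  ... | no ne = ⊥-elim (¬sv (others v uv ne))

  stage-force : ∀ {B ℓ s u w} → (u , w) ∈ ℓ → Γ u w → Stage Γ B ℓ s u →
                (∀ v → Γ u v → toℕ v ≢ toℕ w → Stage Γ B ℓ s v) → Stage Γ B ℓ (suc s) w
  stage-force {B} {ℓ} {s} {u} {w} u→w∈ℓ uw su others with stage? B ℓ s w
  ... | yes sw = inj₁ sw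
  ... | no ¬sw = inj₂ (¬sw , u , u→w∈ℓ , su , uw , only-white others)

  stage-others : ∀ {B ℓ s u w} → (∀ v → Γ u v → ¬ Stage Γ B ℓ s v → v ≡ w) →
                 ∀ v → Γ u v → v ≢ w → Stage Γ B ℓ s v
  stage-others {B} {ℓ} {s} unique v uv v≢w with stage? B ℓ s v
  ... | yes sv = sv
  ... | no ¬sv = ⊥-elim (v≢w (unique v uv ¬sv))

  canForce-intro : ∀ {S u w} → S u → ¬ S w → Γ u w → (∀ v → Γ u v → toℕ v ≢ toℕ w → S v) → CanForce Γ S u w
  canForce-intro su ¬sw uw others = su , ¬sw , uw , only-white others

  source-initial : ∀ {B ℓ} s {v} → IsSource Γ v → Stage Γ B ℓ s v → v ∈ₛ B
  source-initial zero src st = st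
  source-initial (suc s) src (inj₁ st) = source-initial s src st
  source-initial (suc s) src (inj₂ (_ , u , _ , _ , uv , _)) = ⊥-elim (src u uv)

record InvolutiveIso {n : ℕ} (Γa Γb : Digraph n) : Set where
  field
    π : Fin n → Fin n
    involutive : ∀ x → π (π x) ≡ x
    arcs→ : ∀ u v → Γa u v → Γb (π u) (π v)
    arcs← : ∀ u v → Γb u v → Γa (π u) (π v)

iso-sym : ∀ {n} {Γa Γb : Digraph n} → InvolutiveIso Γa Γb → InvolutiveIso Γb Γa
iso-sym I = record { π = π ; involutive = involutive ; arcs→ = arcs← ; arcs← = arcs→ }
  where open InvolutiveIso I

Relabels : ∀ {n} {Γa Γb : Digraph n} → InvolutiveIso Γa Γb → VSet n → VSet n → Set
Relabels I S S' = ∀ y → S' y ⇔ S (InvolutiveIso.π I y)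

canForce-iso : ∀ {n} {Γa Γb : Digraph n} → (I : InvolutiveIso Γa Γb) → ∀ {S S'} → Relabels I S S' →
               ∀ {u w} → CanForce Γa S u w → CanForce Γb S' (InvolutiveIso.π I u) (InvolutiveIso.π I w)
canForce-iso {Γa = Γa} I {S} e {u} {w} (su , ¬sw , uw , unique) =
  from (e (π u)) (subst S (sym (involutive u)) su) ,
  (λ s → ¬sw (subst S (involutive w) (to (e (π w)) s))) ,
  arcs→ u w uw ,
  λ v πu→v ¬sv → trans (sym (involutive v)) (cong π (unique (π v)
    (subst (λ z → Γa z (π v)) (involutive u) (arcs← (π u) v πu→v))
    (λ s → ¬sv (from (e v) s))))
  where open InvolutiveIso I

module IsoTransport {n : ℕ} {Γa Γb : Digraph n} (I : InvolutiveIso Γa Γb) where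
  open InvolutiveIso I

  relabelForce : Fin n × Fin n → Fin n × Fin n
  relabelForce (u , w) = π u , π w

  relabelSubset : Subset n → Subset n
  relabelSubset B = tabulate (λ y → lookup B (π y))

  terminal-iso : ∀ {S S'} → Relabels I S S' → Terminal Γa S → Terminal Γb S'
  terminal-iso {S} {S'} e term u w cf =
    term (π u) (π w) (canForce-iso (iso-sym I) back cf)
    where
    back : Relabels (iso-sym I) S' S
    back y = mk⇔ (λ s → from (e (π y)) (subst S (sym (involutive y)) s))
                 (λ s' → subst S (involutive y) (to (e (π y)) s'))

  validFrom-iso : ∀ ℓ {S S'} → Relabels I S S' → ValidFrom Γa S ℓ → ValidFrom Γb S' (map relabelForce ℓ)
  validFrom-iso [] e term = terminal-iso e term
  validFrom-iso ((u , w) ∷ ℓ) {S} {S'} e (cf , rest) = canForce-iso I e cf , validFrom-iso ℓ e' rest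
    where
    e' : Relabels I (λ x → S x ⊎ x ≡ w) (λ x → S' x ⊎ x ≡ π w)
    e' y = mk⇔ (λ { (inj₁ s) → inj₁ (to (e y) s) ; (inj₂ q) → inj₂ (trans (cong π q) (involutive w)) })
               (λ { (inj₁ s) → inj₁ (from (e y) s) ; (inj₂ q) → inj₂ (trans (sym (involutive y)) (cong π q)) })

  ∈-relabel : ∀ B → Relabels I (λ x → x ∈ₛ B) (λ x → x ∈ₛ relabelSubset B)
  ∈-relabel B y = mk⇔
    (λ m → lookup⇒[]= (π y) B (trans (sym (lookup∘tabulate (λ y → lookup B (π y)) y)) ([]=⇒lookup m)))
    (λ m → lookup⇒[]= y (relabelSubset B) (trans (lookup∘tabulate (λ y → lookup B (π y)) y) ([]=⇒lookup m)))

  ∈-relabelForces : ∀ ℓ u w → (u , w) ∈ map relabelForce ℓ → (π u , π w) ∈ ℓ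
  ∈-relabelForces ℓ u w m with ∈-map⁻ relabelForce m
  ... | (u₀ , w₀) , m₀ , refl = subst (_∈ ℓ) (cong₂ _,_ (sym (involutive u₀)) (sym (involutive w₀))) m₀

  stage-iso : ∀ B ℓ t → Relabels I (Stage Γa B ℓ t) (Stage Γb (relabelSubset B) (map relabelForce ℓ) t)
  stage-iso B ℓ zero = ∈-relabel B
  stage-iso B ℓ (suc t) y = mk⇔ forward backward
    where
    IH : Relabels I (Stage Γa B ℓ t) (Stage Γb (relabelSubset B) (map relabelForce ℓ) t)
    IH = stage-iso B ℓ t
    forward : Stage Γb (relabelSubset B) (map relabelForce ℓ) (suc t) y → Stage Γa B ℓ (suc t) (π y)
    forward (inj₁ s) = inj₁ (to (IH y) s)
    forward (inj₂ (¬s , u , m , su , uy , unique)) =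
      inj₂ ((λ s → ¬s (from (IH y) s)) , π u , ∈-relabelForces ℓ u y m , to (IH u) su , arcs← u y uy ,
            λ v πu→v ¬sv → trans (sym (involutive v)) (cong π (unique (π v)
              (subst (λ z → Γb z (π v)) (involutive u) (arcs→ (π u) v πu→v))
              (λ s → ¬sv (subst (Stage Γa B ℓ t) (involutive v) (to (IH (π v)) s))))))
    backward : Stage Γa B ℓ (suc t) (π y) → Stage Γb (relabelSubset B) (map relabelForce ℓ) (suc t) y
    backward (inj₁ s) = inj₁ (from (IH y) s)
    backward (inj₂ (¬s , u , m , su , uπy , unique)) =
      inj₂ ((λ s → ¬s (to (IH y) s)) , π u ,
            subst (λ z → (π u , z) ∈ map relabelForce ℓ) (involutive y) (∈-map⁺ relabelForce m) ,
            from (IH (π u)) (subst (Stage Γa B ℓ t) (sym (involutive u)) su) ,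
            subst (Γb (π u)) (involutive y) (arcs→ u (π y) uπy) ,
            λ v πu→v ¬sv → trans (sym (involutive v)) (trans (cong π (unique (π v)
              (subst (λ z → Γa z (π v)) (involutive u) (arcs← (π u) v πu→v))
              (λ s → ¬sv (from (IH v) s)))) (involutive y)))

  witness-iso : ∀ B ℓ t → IsForceOrderOf Γa B ℓ → AllBlueAt Γa B ℓ t →
                IsForceOrderOf Γb (relabelSubset B) (map relabelForce ℓ) × AllBlueAt Γb (relabelSubset B) (map relabelForce ℓ) t
  witness-iso B ℓ t valid allBlue =
    validFrom-iso ℓ (∈-relabel B) valid , λ y → from (stage-iso B ℓ t y) (allBlue (π y))

throttling-iso : ∀ {n} {Γa Γb : Digraph n} (I : InvolutiveIso Γa Γb) →
                 (∀ B → ∣ IsoTransport.relabelSubset I B ∣ ≡ ∣ B ∣) →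
                 ∀ k → ThrottlingNumberIs Γa k → ThrottlingNumberIs Γb k
throttling-iso {Γb = Γb} I size k ((B , ℓ , t , valid , allBlue , attained) , lower) =
  (relabelSubset B , map relabelForce ℓ , t , proj₁ witness , proj₂ witness ,
   trans (cong (_+ t) (size B)) attained) ,
  λ B' ℓ' t' valid' allBlue' →
    subst (λ z → k ≤ z + t') (size B') (uncurry (lower (J.relabelSubset B') (map J.relabelForce ℓ') t') (J.witness-iso B' ℓ' t' valid' allBlue'))
  where
  open IsoTransport I
  module J = IsoTransport (iso-sym I)
  witness : IsForceOrderOf Γb (relabelSubset B) (map relabelForce ℓ) × AllBlueAt Γb (relabelSubset B) (map relabelForce ℓ) t
  witness = witness-iso B ℓ t valid allBlue

bit : Bool → ℕ
bit true = 1
bit false = 0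

countBelow : (ℕ → Bool) → ℕ → ℕ
countBelow f zero = zero
countBelow f (suc N) = bit (f 0) + countBelow (λ i → f (suc i)) N

countBelow-ext : ∀ N (f g : ℕ → Bool) → (∀ i → i < N → f i ≡ g i) → countBelow f N ≡ countBelow g N
countBelow-ext zero f g f≗g = refl
countBelow-ext (suc N) f g f≗g = cong₂ _+_ (cong bit (f≗g 0 (s≤s z≤n)))
  (countBelow-ext N (λ i → f (suc i)) (λ i → g (suc i)) (λ i i<N → f≗g (suc i) (s≤s i<N)))

countBelow-const : ∀ N (f : ℕ → Bool) b → (∀ i → i < N → f i ≡ b) → countBelow f N ≡ N * bit b
countBelow-const zero f b fb = refl
countBelow-const (suc N) f b fb = cong₂ _+_ (cong bit (fb 0 (s≤s z≤n)))
  (countBelow-const N (λ i → f (suc i)) b (λ i i<N → fb (suc i) (s≤s i<N)))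

countBelow-zeros : ∀ N (f : ℕ → Bool) → (∀ i → i < N → f i ≡ false) → countBelow f N ≡ 0
countBelow-zeros N f f≡false = trans (countBelow-const N f false f≡false) (*-zeroʳ N)

countBelow-ones : ∀ N (f : ℕ → Bool) → (∀ i → i < N → f i ≡ true) → countBelow f N ≡ N
countBelow-ones N f f≡true = trans (countBelow-const N f true f≡true) (*-identityʳ N)

countBelow-split : ∀ X Y (f : ℕ → Bool) → countBelow f (X + Y) ≡ countBelow f X + countBelow (λ i → f (X + i)) Y
countBelow-split zero Y f = refl
countBelow-split (suc X) Y f = trans (cong (bit (f 0) +_) (countBelow-split X Y (λ i → f (suc i))))
                                     (sym (+-assoc (bit (f 0)) _ _))

countBelow-last : ∀ N (f : ℕ → Bool) → countBelow f (suc N) ≡ countBelow f N + bit (f N)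
countBelow-last zero f = +-comm (bit (f 0)) 0
countBelow-last (suc N) f = trans (cong (bit (f 0) +_) (countBelow-last N (λ i → f (suc i))))
                                  (sym (+-assoc (bit (f 0)) _ _))

countBelow-true : ∀ f j → f j ≡ true → countBelow f (suc j) ≡ suc (countBelow f j)
countBelow-true f j fj = trans (countBelow-last j f) (trans (cong (λ b → countBelow f j + bit b) fj) (+-comm _ 1))

countBelow-reverse : ∀ N (f : ℕ → Bool) → countBelow f N ≡ countBelow (λ i → f (N ∸ suc i)) N
countBelow-reverse zero f = refl
countBelow-reverse (suc N) f = trans (countBelow-last N f)
  (trans (+-comm (countBelow f N) _) (cong (bit (f N) +_) (countBelow-reverse N f)))

countBelow-mono : ∀ {X Y} (f : ℕ → Bool) → X ≤ Y → countBelow f X ≤ countBelow f Y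
countBelow-mono f z≤n = z≤n
countBelow-mono f (s≤s X≤Y) = +-monoʳ-≤ (bit (f 0)) (countBelow-mono (λ i → f (suc i)) X≤Y)

countBelow-evenOdd : ∀ M (f : ℕ → Bool) →
  countBelow f (M + M) ≡ countBelow (λ j → f (j + j)) M + countBelow (λ j → f (suc (j + j))) M
countBelow-evenOdd zero f = refl
countBelow-evenOdd (suc M) f = begin
    countBelow f (suc M + suc M)
  ≡⟨ cong (λ z → a + countBelow (λ i → f (suc i)) z) (+-suc M M) ⟩
    a + (b + countBelow (λ i → f (suc (suc i))) (M + M))
  ≡⟨ cong (λ z → a + (b + z)) (countBelow-evenOdd M (λ i → f (suc (suc i)))) ⟩
    a + (b + (evens + odds))
  ≡⟨ interchange a b evens odds ⟩
    (a + evens) + (b + odds)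
  ≡⟨ cong₂ (λ x y → (a + x) + (b + y))
       (countBelow-ext M _ _ (λ i _ → cong f (cong suc (sym (+-suc i i)))))
       (countBelow-ext M _ _ (λ i _ → cong f (cong (λ z → suc (suc z)) (sym (+-suc i i))))) ⟩
    countBelow (λ j → f (j + j)) (suc M) + countBelow (λ j → f (suc (j + j))) (suc M)
  ∎
  where
  open ≡-Reasoning
  a b evens odds : ℕ
  a = bit (f 0)
  b = bit (f 1)
  evens = countBelow (λ j → f (suc (suc (j + j)))) M
  odds = countBelow (λ j → f (suc (suc (suc (j + j))))) M
  interchange : ∀ a b c d → a + (b + (c + d)) ≡ (a + c) + (b + d)
  interchange = solve 4 (λ a b c d → a :+ (b :+ (c :+ d)) := (a :+ c) :+ (b :+ d)) refl

indicator : ∀ {n} → Subset n → ℕ → Bool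
indicator [] i = false
indicator (x ∷ B) zero = x
indicator (x ∷ B) (suc i) = indicator B i

indicator-lookup : ∀ {n} (B : Subset n) x → indicator B (toℕ x) ≡ lookup B x
indicator-lookup (b ∷ B) fz = refl
indicator-lookup (b ∷ B) (fs x) = indicator-lookup B x

indicator-∈ : ∀ {n} (B : Subset n) x → x ∈ₛ B → indicator B (toℕ x) ≡ true
indicator-∈ B x x∈B = trans (indicator-lookup B x) ([]=⇒lookup x∈B)

indicator-beyond : ∀ {n} (B : Subset n) i → n ≤ i → indicator B i ≡ false
indicator-beyond [] i n≤i = refl
indicator-beyond (b ∷ B) (suc i) (s≤s n≤i) = indicator-beyond B i n≤i

∣∣-indicator : ∀ {n} (B : Subset n) → ∣ B ∣ ≡ countBelow (indicator B) n
∣∣-indicator [] = refl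
∣∣-indicator (true ∷ B) = cong suc (∣∣-indicator B)
∣∣-indicator (false ∷ B) = ∣∣-indicator B

∣∣-tabulate : ∀ n (g : ℕ → Bool) → ∣ tabulate {n = n} (λ x → g (toℕ x)) ∣ ≡ countBelow g n
∣∣-tabulate zero g = refl
∣∣-tabulate (suc n) g with g 0
... | true = cong suc (∣∣-tabulate n (λ i → g (suc i)))
... | false = ∣∣-tabulate n (λ i → g (suc i))

∣∣-reverse : ∀ {n} (B : Subset n) → ∣ tabulate (λ y → lookup B (opposite y)) ∣ ≡ ∣ B ∣
∣∣-reverse {n} B = begin
    ∣ tabulate (λ y → lookup B (opposite y)) ∣
  ≡⟨ cong ∣_∣ (tabulate-cong (λ y → trans (sym (indicator-lookup B (opposite y))) (cong (indicator B) (Finₚ.opposite-prop y)))) ⟩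
    ∣ tabulate {n = n} (λ y → indicator B (n ∸ suc (toℕ y))) ∣
  ≡⟨ ∣∣-tabulate n (λ i → indicator B (n ∸ suc i)) ⟩
    countBelow (λ i → indicator B (n ∸ suc i)) n
  ≡⟨ sym (countBelow-reverse n (indicator B)) ⟩
    countBelow (indicator B) n
  ≡⟨ sym (∣∣-indicator B) ⟩
    ∣ B ∣
  ∎
  where open ≡-Reasoning

odd : ℕ → Bool
odd zero = false
odd (suc i) = not (odd i)

odd-double : ∀ j → odd (j + j) ≡ false
odd-double zero = refl
odd-double (suc j) rewrite +-suc j j | odd-double j = refl

odd-+ : ∀ x y → odd (x + y) ≡ odd x xor odd y
odd-+ zero y = refl
odd-+ (suc x) y = trans (cong not (odd-+ x y)) (not-distribˡ-xor (odd x) (odd y))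

2*≡+ : ∀ m → 2 * m ≡ m + m
2*≡+ m = cong (m +_) (+-identityʳ m)

suc+suc : ∀ j → suc j + suc j ≡ suc (suc (j + j))
suc+suc j = cong suc (+-suc j j)

halve : ∀ i → Σ ℕ λ j → i ≡ j + j ⊎ i ≡ suc (j + j)
halve zero = 0 , inj₁ refl
halve (suc i) with halve i
... | j , inj₁ e = j , inj₂ (cong suc e)
... | j , inj₂ e = suc j , inj₁ (trans (cong suc e) (sym (suc+suc j)))

double-injective : ∀ a b → a + a ≡ b + b → a ≡ b
double-injective a b e with <-cmp a b
... | tri< a<b _ _ = ⊥-elim (<-irrefl e (+-mono-< a<b a<b))
... | tri≈ _ a≡b _ = a≡b
... | tri> _ _ a>b = ⊥-elim (<-irrefl (sym e) (+-mono-< a>b a>b))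

odd<double : ∀ {m j} → j < m → suc (j + j) < 2 * m
odd<double {m} {j} j<m = ≤-trans (≤-reflexive (sym (suc+suc j))) (≤-trans (+-mono-≤ j<m j<m) (≤-reflexive (sym (2*≡+ m))))

even<double : ∀ {m j} → j < m → j + j < 2 * m
even<double j<m = <⇒≤ (odd<double j<m)

half< : ∀ {j m} → j + j < 2 * m → j < m
half< {j} {m} lt with j <? m
... | yes j<m = j<m
... | no j≮m = ⊥-elim (<⇒≱ (≤-trans lt (≤-reflexive (2*≡+ m))) (+-mono-≤ (≮⇒≥ j≮m) (≮⇒≥ j≮m)))

sink-index< : ∀ {m j} (x : Fin (2 * m)) → toℕ x ≡ suc (j + j) → j < m
sink-index< x x≡ = half< (≤-trans (n≤1+n _) (≤-trans (≤-reflexive (cong suc (sym x≡))) (Finₚ.toℕ<n x)))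

∸-suc : ∀ {a d} → d < a → a ∸ d ≡ suc (a ∸ suc d)
∸-suc {suc a} {zero} _ = refl
∸-suc {suc a} {suc d} (s≤s d<a) = ∸-suc d<a

-- The coverage bound is dominated by the square bound:
-- (b+t+1)² − (2(t + (2t+1)·b) + 1) = (b − t)².
coverage≤square : ∀ b t → suc (2 * (t + suc (t + t) * b)) ≤ suc (b + t) * suc (b + t)
coverage≤square b t with ≤-total b t
... | inj₁ b≤t with m≤n⇒∃[o]m+o≡n b≤t
...   | d , refl = ≤-trans (m≤m+n _ (d * d)) (≤-reflexive (sym (identity b d)))
  where
  identity : ∀ b d → suc (b + (b + d)) * suc (b + (b + d)) ≡ suc (2 * ((b + d) + suc ((b + d) + (b + d)) * b)) + d * d
  identity = solve 2 (λ b d → (con 1 :+ (b :+ (b :+ d))) :* (con 1 :+ (b :+ (b :+ d))) :=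
                              con 1 :+ (con 2 :* ((b :+ d) :+ (con 1 :+ ((b :+ d) :+ (b :+ d))) :* b)) :+ d :* d) refl
coverage≤square b t | inj₂ t≤b with m≤n⇒∃[o]m+o≡n t≤b
...   | d , refl = ≤-trans (m≤m+n _ (d * d)) (≤-reflexive (sym (identity t d)))
  where
  identity : ∀ t d → suc ((t + d) + t) * suc ((t + d) + t) ≡ suc (2 * (t + suc (t + t) * (t + d))) + d * d
  identity = solve 2 (λ t d → (con 1 :+ ((t :+ d) :+ t)) :* (con 1 :+ ((t :+ d) :+ t)) :=
                              con 1 :+ (con 2 :* (t :+ (con 1 :+ (t :+ t)) :* (t :+ d))) :+ d :* d) refl

balancedSplit : ∀ k → Σ ℕ λ t → Σ ℕ λ b → k ≡ b + t × (b ≡ t ⊎ b ≡ suc t)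
balancedSplit zero = 0 , 0 , refl , inj₁ refl
balancedSplit (suc k) with balancedSplit k
... | t , b , refl , inj₁ refl = t , suc t , refl , inj₂ refl
... | t , b , refl , inj₂ refl = suc t , suc t , cong suc (sym (+-suc t t)) , inj₁ refl

square⇒coverage : ∀ m t b → (b ≡ t ⊎ b ≡ suc t) → suc (2 * m) ≤ suc (b + t) * suc (b + t) →
                  m ≤ t + suc (t + t) * b
square⇒coverage m t .t (inj₁ refl) le =
  *-cancelˡ-≤ 2 (≤-pred (≤-trans le (≤-reflexive (identity t))))
  where
  identity : ∀ t → suc (t + t) * suc (t + t) ≡ suc (2 * (t + suc (t + t) * t))
  identity = solve 1 (λ t → (con 1 :+ (t :+ t)) :* (con 1 :+ (t :+ t)) := con 1 :+ con 2 :* (t :+ (con 1 :+ (t :+ t)) :* t)) refl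
square⇒coverage m t .(suc t) (inj₂ refl) le =
  ≤-pred (*-cancelˡ-< 2 m _ (≤-trans (≤-trans le (≤-reflexive (identity t))) (≤-reflexive (sym (*-suc 2 _)))))
  where
  identity : ∀ t → suc (suc t + t) * suc (suc t + t) ≡ suc (suc (2 * (t + suc (t + t) * suc t)))
  identity = solve 1 (λ t → (con 1 :+ (con 1 :+ t :+ t)) :* (con 1 :+ (con 1 :+ t :+ t)) :=
                            con 2 :+ con 2 :* (t :+ (con 1 :+ (t :+ t)) :* (con 1 :+ t))) refl

-- 3. The canonical alternating path and the lower bound

Γc : ∀ {n} → Digraph n
Γc u v = odd (toℕ u) ≡ false × (toℕ v ≡ suc (toℕ u) ⊎ toℕ u ≡ suc (toℕ v))

Γc? : ∀ {n} (u v : Fin n) → Dec (Γc u v)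
Γc? u v = (odd (toℕ u) ≟ᵇ false) ×-dec ((toℕ v ≟ suc (toℕ u)) ⊎-dec (toℕ u ≟ suc (toℕ v)))

even-consecutive : ∀ i → odd i ≡ false → odd (suc i) ≡ false → ⊥
even-consecutive i even-i even-1+i rewrite even-i with even-1+i
... | ()

Γc-source : ∀ {n} {v : Fin n} → odd (toℕ v) ≡ false → IsSource Γc v
Γc-source even-v u (even-u , inj₁ v≡1+u) = even-consecutive (toℕ u) even-u (subst (λ i → odd i ≡ false) v≡1+u even-v)
Γc-source {v = v} even-v u (even-u , inj₂ u≡1+v) = even-consecutive (toℕ v) even-v (subst (λ i → odd i ≡ false) u≡1+v even-u)

-- Sink j is covered within s steps by the initially blue sinks f if it can
-- be reached from the left end of the path (j < s) or lies within
-- distance s of an initially blue sink j'.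
Covered : (ℕ → Bool) → ℕ → ℕ → Set
Covered f s j = j < s ⊎ Σ ℕ λ j' → j' ≤ j + s × f j' ≡ true × j ≤ j' + s

covered-later : ∀ f s j → Covered f s j → Covered f (suc s) j
covered-later f s j (inj₁ j<s) = inj₁ (m≤n⇒m≤1+n j<s)
covered-later f s j (inj₂ (j' , j'≤ , fj' , j≤)) =
  inj₂ (j' , ≤-trans j'≤ (+-monoʳ-≤ j (n≤1+n s)) , fj' , ≤-trans j≤ (+-monoʳ-≤ j' (n≤1+n s)))

covered-leftOf : ∀ f s j → Covered f s (suc j) → Covered f (suc s) j
covered-leftOf f s j (inj₁ 1+j<s) = inj₁ (m≤n⇒m≤1+n (<⇒≤ 1+j<s))
covered-leftOf f s j (inj₂ (j' , j'≤ , fj' , j≤)) =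
  inj₂ (j' , ≤-trans j'≤ (≤-reflexive (sym (+-suc j s))) , fj' , ≤-trans (n≤1+n j) (≤-trans j≤ (+-monoʳ-≤ j' (n≤1+n s))))

covered-rightOf : ∀ f s j → Covered f s j → Covered f (suc s) (suc j)
covered-rightOf f s j (inj₁ j<s) = inj₁ (s≤s j<s)
covered-rightOf f s j (inj₂ (j' , j'≤ , fj' , j≤)) =
  inj₂ (j' , ≤-trans j'≤ (≤-trans (n≤1+n _) (s≤s (+-monoʳ-≤ j (n≤1+n s)))) , fj' , ≤-trans (s≤s j≤) (≤-reflexive (sym (+-suc j' s))))

-- If the sinks j < N are all covered within t steps, then
--   N ≤ t + (2t+1) · #{ blue sinks below N + t }:
-- the top sink is either among the t leftmost ones, or it lies within
-- distance t of a blue sink j'; all sinks below j' − t are covered by the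
-- blue sinks below j', and j' itself accounts for 2t+1 further sinks.
covered-count : ∀ t f N → (∀ j → j < N → Covered f t j) → N ≤ t + suc (t + t) * countBelow f (N + t)
covered-count t f = <-rec (λ N → (∀ j → j < N → Covered f t j) → N ≤ t + W * #f (N + t)) step
  where
  W : ℕ
  W = suc (t + t)
  #f : ℕ → ℕ
  #f = countBelow f
  step : ∀ N → (∀ {N'} → N' < N → (∀ j → j < N' → Covered f t j) → N' ≤ t + W * #f (N' + t)) →
         (∀ j → j < N → Covered f t j) → N ≤ t + W * #f (N + t)
  step zero _ _ = z≤n
  step (suc N) IH cov with cov N ≤-refl
  ... | inj₁ N<t = ≤-trans N<t (m≤m+n t _)
  ... | inj₂ (j' , j'≤N+t , fj' , N≤j'+t) = ≤-trans (s≤s N≤j'+t) (bound (t ≤? j'))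
    where
    #f-j' : suc (#f j') ≤ #f (suc N + t)
    #f-j' = ≤-trans (≤-reflexive (sym (countBelow-true f j' fj'))) (countBelow-mono f (s≤s j'≤N+t))
    bound : Dec (t ≤ j') → suc (j' + t) ≤ t + W * #f (suc N + t)
    bound (no t≰j') = ≤-trans (+-monoˡ-≤ t (≰⇒> t≰j'))
                        (+-monoʳ-≤ t (≤-trans (≤-trans (m≤m+n t t) (n≤1+n _))
                          (≤-trans (≤-reflexive (sym (*-identityʳ W))) (*-monoʳ-≤ W (≤-trans (s≤s z≤n) #f-j')))))
    bound (yes t≤j') with m≤n⇒∃[o]m+o≡n t≤j'
    ... | N' , refl = ≤-trans (s≤s (+-monoˡ-≤ t (+-monoʳ-≤ t IH')))
                        (≤-trans (≤-reflexive (identity t (W * #f (t + N'))))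
                          (+-monoʳ-≤ t (≤-trans (≤-reflexive (sym (*-suc W (#f (t + N'))))) (*-monoʳ-≤ W #f-j'))))
      where
      N'<1+N : N' < suc N
      N'<1+N = s≤s (+-cancelˡ-≤ t N' N (≤-trans (≤-pred (s≤s j'≤N+t)) (≤-reflexive (+-comm N t))))
      IH' : N' ≤ t + W * #f (t + N')
      IH' = subst (λ z → N' ≤ t + W * #f z) (+-comm N' t)
              (IH N'<1+N (λ j j<N' → cov j (≤-trans j<N' (≤-pred (m≤n⇒m≤1+n N'<1+N)))))
      identity : ∀ t X → suc ((t + (t + X)) + t) ≡ t + (suc (t + t) + X)
      identity = solve 2 (λ t X → con 1 :+ ((t :+ (t :+ X)) :+ t) := t :+ ((con 1 :+ (t :+ t)) :+ X)) refl

module LowerBound (m : ℕ) (B : Subset (2 * m)) (ℓ : List (Fin (2 * m) × Fin (2 * m))) where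
  open Forcing (Γc {2 * m}) Γc?

  St : ℕ → VSet (2 * m)
  St = Stage Γc B ℓ

  blueSink : ℕ → Bool
  blueSink j = indicator B (suc (j + j))

  -- Every sink that is blue at stage s is covered within s steps: it was
  -- initially blue, or forced by a neighbouring source whose other
  -- out-neighbour (the next sink outwards) was blue one step earlier; the
  -- source at position 0 has no other out-neighbour, so sink 0 is covered
  -- from the left end.
  covered : ∀ s (v : Fin (2 * m)) j → toℕ v ≡ suc (j + j) → St s v → Covered blueSink s j
  covered zero v j v≡ st = inj₂ (j , m≤m+n j 0 , trans (cong (indicator B) (sym v≡)) (indicator-∈ B v st) , m≤m+n j 0)
  covered (suc s) v j v≡ (inj₁ st) = covered-later blueSink s j (covered s v j v≡ st)
  covered (suc s) v zero v≡ (inj₂ (_ , u , _ , _ , (_ , inj₁ _) , _)) = inj₁ (s≤s z≤n)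
  covered (suc s) v (suc j) v≡ (inj₂ (_ , u , _ , _ , (even-u , inj₁ v≡1+u) , unique)) =
    covered-rightOf blueSink s j (covered s v' j v'≡ (stage-others unique v' (even-u , inj₂ u≡1+v') v'≢v))
    where
    bound : suc (j + j) < 2 * m
    bound = odd<double {m} (<⇒≤ (sink-index< v v≡))
    v' : Fin (2 * m)
    v' = fromℕ< bound
    v'≡ : toℕ v' ≡ suc (j + j)
    v'≡ = Finₚ.toℕ-fromℕ< bound
    u≡1+v' : toℕ u ≡ suc (toℕ v')
    u≡1+v' = suc-injective (trans (sym v≡1+u) (trans v≡ (cong suc (trans (suc+suc j) (cong suc (sym v'≡))))))
    v'≢v : v' ≢ v
    v'≢v v'≡v = <-irrefl (cong toℕ v'≡v) (≤-trans (s≤s (≤-reflexive v'≡)) (≤-trans (s≤s (s≤s (n≤1+n _))) (≤-reflexive (sym (trans v≡ (cong suc (suc+suc j)))))))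
  covered (suc s) v j v≡ (inj₂ (_ , u , _ , _ , (even-u , inj₂ u≡1+v) , unique)) =
    covered-leftOf blueSink s j (covered s v' (suc j) v'≡ (stage-others unique v' (even-u , inj₁ v'≡1+u) v'≢v))
    where
    u≡ : toℕ u ≡ suc j + suc j
    u≡ = trans u≡1+v (trans (cong suc v≡) (sym (suc+suc j)))
    bound : suc (suc j + suc j) < 2 * m
    bound = odd<double {m} (half< {suc j} {m} (≤-trans (≤-reflexive (cong suc (sym u≡))) (Finₚ.toℕ<n u)))
    v' : Fin (2 * m)
    v' = fromℕ< bound
    v'≡ : toℕ v' ≡ suc (suc j + suc j)
    v'≡ = Finₚ.toℕ-fromℕ< bound
    v'≡1+u : toℕ v' ≡ suc (toℕ u)
    v'≡1+u = trans v'≡ (cong suc (sym u≡))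
    v'≢v : v' ≢ v
    v'≢v v'≡v = <-irrefl (cong toℕ (sym v'≡v)) (≤-trans (≤-reflexive (trans (sym u≡1+v) u≡)) (≤-trans (n≤1+n _) (≤-reflexive (sym v'≡))))

  b : ℕ
  b = countBelow blueSink m

  -- Sources are never forced, so all m of them are in B and |B| = m + b.
  ∣B∣≡m+b : ∀ t → AllBlueAt Γc B ℓ t → ∣ B ∣ ≡ m + b
  ∣B∣≡m+b t allBlue = begin
      ∣ B ∣
    ≡⟨ ∣∣-indicator B ⟩
      countBelow (indicator B) (2 * m)
    ≡⟨ cong (countBelow (indicator B)) (2*≡+ m) ⟩
      countBelow (indicator B) (m + m)
    ≡⟨ countBelow-evenOdd m (indicator B) ⟩
      countBelow (λ j → indicator B (j + j)) m + b
    ≡⟨ cong (_+ b) (countBelow-ones m _ source∈B) ⟩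
      m + b
    ∎
    where
    open ≡-Reasoning
    source∈B : ∀ j → j < m → indicator B (j + j) ≡ true
    source∈B j j<m = trans (cong (indicator B) (sym (Finₚ.toℕ-fromℕ< (even<double j<m))))
      (indicator-∈ B _ (source-initial t (Γc-source (trans (cong odd (Finₚ.toℕ-fromℕ< (even<double j<m))) (odd-double j))) (allBlue _)))

  -- All m sinks are covered within t steps, so m ≤ t + (2t+1)·b.
  sinks-covered : ∀ t → AllBlueAt Γc B ℓ t → m ≤ t + suc (t + t) * b
  sinks-covered t allBlue = subst (λ z → m ≤ t + suc (t + t) * z) no-blue-beyond
    (covered-count t blueSink m (λ j j<m → covered t _ j (Finₚ.toℕ-fromℕ< (odd<double j<m)) (allBlue _)))
    where
    no-blue-beyond : countBelow blueSink (m + t) ≡ b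
    no-blue-beyond = trans (countBelow-split m t blueSink)
      (trans (cong (b +_) (countBelow-zeros t _ (λ i _ → indicator-beyond B _
               (≤-trans (≤-reflexive (2*≡+ m)) (≤-trans (+-mono-≤ (m≤m+n m i) (m≤m+n m i)) (n≤1+n _))))))
             (+-identityʳ b))

  lowerBound : ∀ t → AllBlueAt Γc B ℓ t → ∀ k → (∀ j → suc (2 * m) ≤ suc j * suc j → k ≤ j) → m + k ≤ ∣ B ∣ + t
  lowerBound t allBlue k k-least = begin
      m + k
    ≤⟨ +-monoʳ-≤ m (k-least (b + t) (≤-trans (s≤s (*-monoʳ-≤ 2 (sinks-covered t allBlue))) (coverage≤square b t))) ⟩
      m + (b + t)
    ≡⟨ sym (+-assoc m b t) ⟩
      (m + b) + t
    ≡⟨ cong (_+ t) (sym (∣B∣≡m+b t allBlue)) ⟩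
      ∣ B ∣ + t
    ∎
    where open ≤-Reasoning

-- 4a. The periodic seed pattern

-- The role of a sink in the construction: initially blue, forced by the
-- source on its right (a leftward force), or by the source on its left.
data Kind : Set where
  seed leftward rightward : Kind

seed≢leftward : seed ≢ leftward
seed≢leftward ()

seed≢rightward : seed ≢ rightward
seed≢rightward ()

leftward≢rightward : leftward ≢ rightward
leftward≢rightward ()

isSeed : Kind → Bool
isSeed seed = true
isSeed leftward = false
isSeed rightward = false

module Pattern (t : ℕ) where

  -- One period: a seed followed (to the left) by t leftward sinks and t
  -- rightward sinks.
  W : ℕ
  W = suc (t + t)

  -- Kind and forcing time of the sink with residue r in its period:
  -- residue 0 is the seed, residues 1 … t are leftward sinks forced at
  -- time r (a chain moving left from the seed), residues t+1 … 2t are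
  -- rightward sinks forced at time W − r (a chain moving right towards
  -- the next seed).
  kindRes : ℕ → Kind
  kindRes zero = seed
  kindRes (suc r) with suc r ≤? t
  ... | yes _ = leftward
  ... | no _ = rightward

  timeRes : ℕ → ℕ
  timeRes zero = 0
  timeRes (suc r) with suc r ≤? t
  ... | yes _ = suc r
  ... | no _ = W ∸ suc r

  -- Sinks are numbered D = 0, 1, … from the right end of the path; the
  -- seeds sit at D = t, t + W, t + 2W, …, so the t rightmost sinks are
  -- rightward sinks fed by the first seed.
  residue : ℕ → ℕ
  residue D = (D + suc t) % W

  kindAt : ℕ → Kind
  kindAt D = kindRes (residue D)

  timeAt : ℕ → ℕ
  timeAt D = timeRes (residue D)

  suc-% : ∀ e → suc e % W ≡ suc (e % W) % W
  suc-% e = trans (cong (λ x → suc x % W) (m≡m%n+[m/n]*n e W)) ([m+kn]%n≡m%n (suc (e % W)) (e / W) W)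

  residue-suc : ∀ D → (residue D < t + t × residue (suc D) ≡ suc (residue D)) ⊎
                      (residue D ≡ t + t × residue (suc D) ≡ 0)
  residue-suc D with m≤n⇒m<n∨m≡n (≤-pred (m%n<n (D + suc t) W))
  ... | inj₁ r<2t = inj₁ (r<2t , trans (suc-% (D + suc t)) (m<n⇒m%n≡m (s≤s r<2t)))
  ... | inj₂ r≡2t = inj₂ (r≡2t , trans (suc-% (D + suc t)) (trans (cong (λ r → suc r % W) r≡2t) (n%n≡0 W)))

  timeRes≤t : ∀ r → timeRes r ≤ t
  timeRes≤t zero = z≤n
  timeRes≤t (suc r) with suc r ≤? t
  ... | yes r<t = r<t
  ... | no r≮t = m≤n+o⇒m∸n≤o W (suc r) (s≤s (+-monoˡ-≤ t (≤-pred (≰⇒> r≮t))))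

  timeRes-rightward : ∀ r → r < W → kindRes r ≡ rightward → 1 ≤ timeRes r
  timeRes-rightward zero _ ()
  timeRes-rightward (suc r) r<W k with suc r ≤? t
  timeRes-rightward (suc r) r<W () | yes _
  ... | no _ = m<n⇒0<n∸m r<W

  rightwardRes-next : ∀ r → r < t + t → kindRes r ≡ rightward →
                      kindRes (suc r) ≡ rightward × timeRes r ≡ suc (timeRes (suc r))
  rightwardRes-next zero _ ()
  rightwardRes-next (suc r) r<2t k with suc r ≤? t
  rightwardRes-next (suc r) r<2t () | yes _
  ... | no r≮t with suc (suc r) ≤? t
  ...   | yes 1+r<t = ⊥-elim (r≮t (≤-trans (n≤1+n _) 1+r<t))
  ...   | no _ = refl , ∸-suc (s≤s (<⇒≤ r<2t))

  rightwardRes-last : ∀ r → r ≡ t + t → kindRes r ≡ rightward → timeRes r ≡ 1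
  rightwardRes-last zero _ ()
  rightwardRes-last (suc r) _ k with suc r ≤? t
  rightwardRes-last (suc r) _ () | yes _
  rightwardRes-last (suc r) r≡2t _ | no _ = trans (cong (W ∸_) r≡2t) (m+n∸n≡m 1 (t + t))

  leftwardRes-prev : ∀ r → kindRes (suc r) ≡ leftward →
                     (r ≡ 0 × timeRes (suc r) ≡ 1) ⊎ (kindRes r ≡ leftward × timeRes (suc r) ≡ suc (timeRes r))
  leftwardRes-prev r k with suc r ≤? t
  leftwardRes-prev r () | no _
  leftwardRes-prev zero _ | yes _ = inj₁ (refl , refl)
  leftwardRes-prev (suc r) _ | yes 1+r≤t with suc r ≤? t
  ... | yes _ = inj₂ (refl , refl)
  ... | no r≰t = ⊥-elim (r≰t (≤-trans (n≤1+n _) 1+r≤t))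

  isSeed-kindRes-suc : ∀ r → isSeed (kindRes (suc r)) ≡ false
  isSeed-kindRes-suc r with suc r ≤? t
  ... | yes _ = refl
  ... | no _ = refl

  timeAt≤t : ∀ D → timeAt D ≤ t
  timeAt≤t D = timeRes≤t (residue D)

  rightward-time>0 : ∀ D → kindAt D ≡ rightward → 1 ≤ timeAt D
  rightward-time>0 D = timeRes-rightward (residue D) (m%n<n (D + suc t) W)

  rightward-left : ∀ D → kindAt D ≡ rightward →
                   (kindAt (suc D) ≡ seed × timeAt D ≡ 1) ⊎ (kindAt (suc D) ≡ rightward × timeAt D ≡ suc (timeAt (suc D)))
  rightward-left D k with residue-suc D
  ... | inj₂ (r≡2t , r'≡0) = inj₁ (cong kindRes r'≡0 , rightwardRes-last (residue D) r≡2t k)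
  ... | inj₁ (r<2t , r'≡1+r) rewrite r'≡1+r = inj₂ (rightwardRes-next (residue D) r<2t k)

  leftward-right : ∀ D → kindAt (suc D) ≡ leftward →
                   (kindAt D ≡ seed × timeAt (suc D) ≡ 1) ⊎ (kindAt D ≡ leftward × timeAt (suc D) ≡ suc (timeAt D))
  leftward-right D k with residue-suc D
  ... | inj₂ (_ , r'≡0) = ⊥-elim (seed≢leftward (trans (sym (cong kindRes r'≡0)) k))
  ... | inj₁ (_ , r'≡1+r) rewrite r'≡1+r with leftwardRes-prev (residue D) k
  ...   | inj₁ (r≡0 , time) = inj₁ (cong kindRes r≡0 , time)
  ...   | inj₂ prev = inj₂ prev

  -- The rightmost sink is not leftward: there is no source to its right.
  leftward-0 : kindAt 0 ≢ leftward
  leftward-0 = notLeftward (residue 0) refl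
    where
    notLeftward : ∀ r → r ≡ suc t % W → kindRes r ≢ leftward
    notLeftward zero _ ()
    notLeftward (suc r) _ k with suc r ≤? t
    notLeftward (suc r) _ () | no _
    notLeftward (suc r) r≡ _ | yes 1+r≤t = <-irrefl refl (≤-trans (≤-reflexive (sym 1+r≡1+t)) 1+r≤t)
      where
      1+r≡1+t : suc r ≡ suc t
      1+r≡1+t = trans r≡ (m<n⇒m%n≡m (s≤s (+-monoˡ-≤ t (≤-trans (s≤s z≤n) 1+r≤t))))

  -- Exactly one seed per period …
  seeds-periods : ∀ b → countBelow (λ e → isSeed (kindRes (e % W))) (W * b) ≡ b
  seeds-periods zero = cong (countBelow _) (*-zeroʳ W)
  seeds-periods (suc b) = begin
      countBelow seedAt (W * suc b)
    ≡⟨ cong (countBelow seedAt) (*-suc W b) ⟩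
      countBelow seedAt (W + W * b)
    ≡⟨ countBelow-split W (W * b) seedAt ⟩
      countBelow seedAt W + countBelow (λ e → seedAt (W + e)) (W * b)
    ≡⟨ cong₂ _+_ one-period (countBelow-ext (W * b) _ _ (λ e _ → cong (λ r → isSeed (kindRes r)) (shift e))) ⟩
      1 + countBelow seedAt (W * b)
    ≡⟨ cong suc (seeds-periods b) ⟩
      suc b
    ∎
    where
    open ≡-Reasoning
    seedAt : ℕ → Bool
    seedAt e = isSeed (kindRes (e % W))
    one-period : countBelow seedAt W ≡ 1
    one-period = cong suc (countBelow-zeros (t + t) _ (λ i i<2t →
                   trans (cong (λ r → isSeed (kindRes r)) (m<n⇒m%n≡m (s≤s i<2t))) (isSeed-kindRes-suc i)))
    shift : ∀ e → (W + e) % W ≡ e % W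
    shift e = trans (cong (_% W) (+-comm W e)) ([m+n]%n≡m%n e W)

  -- … and none among the t rightmost sinks, so there are at most b seeds
  -- among the first m ≤ t + W·b sinks.
  seeds≤ : ∀ m b → m ≤ t + W * b → countBelow (λ D → isSeed (kindAt D)) m ≤ b
  seeds≤ m b m≤ = ≤-trans (countBelow-mono _ m≤) (≤-reflexive (begin
      countBelow (λ D → isSeed (kindAt D)) (t + W * b)
    ≡⟨ countBelow-split t (W * b) _ ⟩
      countBelow (λ D → isSeed (kindAt D)) t + countBelow (λ e → isSeed (kindAt (t + e))) (W * b)
    ≡⟨ cong₂ _+_ (countBelow-zeros t _ first-t) (countBelow-ext (W * b) _ _ (λ e _ → cong (λ r → isSeed (kindRes r)) (residue-shift e))) ⟩
      countBelow (λ e → isSeed (kindRes (e % W))) (W * b)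
    ≡⟨ seeds-periods b ⟩
      b
    ∎))
    where
    open ≡-Reasoning
    first-t : ∀ D → D < t → isSeed (kindAt D) ≡ false
    first-t D D<t = trans (cong (λ r → isSeed (kindRes r)) (trans (m<n⇒m%n≡m D+1+t<W) (+-suc D t)))
                          (isSeed-kindRes-suc (D + t))
      where
      D+1+t<W : D + suc t < W
      D+1+t<W = ≤-trans (+-monoˡ-< (suc t) D<t) (≤-reflexive (+-suc t t))
    residue-shift : ∀ e → residue (t + e) ≡ e % W
    residue-shift e = trans (cong (_% W) (arith t e)) ([m+n]%n≡m%n e W)
      where
      arith : ∀ t e → t + e + suc t ≡ e + suc (t + t)
      arith = solve 2 (λ t e → t :+ e :+ (con 1 :+ t) := e :+ (con 1 :+ (t :+ t))) refl

-- 4b. The construction for the upper bound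

-- The vertex at position i of a path with N+1 vertices (positions beyond
-- the path are sent to 0; they never occur below).
clamp : ∀ {N} → ℕ → Fin (suc N)
clamp zero = fz
clamp {zero} (suc i) = fz
clamp {suc N} (suc i) = fs (clamp i)

toℕ-clamp : ∀ {N} i → i < suc N → toℕ (clamp {N} i) ≡ i
toℕ-clamp zero _ = refl
toℕ-clamp {zero} (suc i) (s≤s ())
toℕ-clamp {suc N} (suc i) (s≤s i<1+N) = cong suc (toℕ-clamp i i<1+N)

withSources : (ℕ → Bool) → ℕ → Bool
withSources g zero = true
withSources g (suc zero) = g 0
withSources g (suc (suc i)) = withSources (λ j → g (suc j)) i

withSources-even : ∀ g j → withSources g (j + j) ≡ true
withSources-even g zero = refl
withSources-even g (suc j) rewrite +-suc j j = withSources-even (λ j → g (suc j)) j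

withSources-odd : ∀ g j → withSources g (suc (j + j)) ≡ g j
withSources-odd g zero = refl
withSources-odd g (suc j) rewrite +-suc j j = withSources-odd (λ j → g (suc j)) j

Describes : ∀ {n} → (ℕ → Set) → VSet n → Set
Describes P S = ∀ x → S x ⇔ P (toℕ x)

describes-⇔ : ∀ {n} {P Q : ℕ → Set} {S : VSet n} → (∀ i → P i ⇔ Q i) → Describes P S → Describes Q S
describes-⇔ P⇔Q e x = mk⇔ (λ s → to (P⇔Q _) (to (e x) s)) (λ q → from (e x) (from (P⇔Q _) q))

describes-add : ∀ {n} {P Q : ℕ → Set} {S : VSet n} {w i₀} → Describes P S → toℕ w ≡ i₀ →
                (∀ i → Q i ⇔ (P i ⊎ i ≡ i₀)) → Describes Q (λ x → S x ⊎ x ≡ w)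
describes-add e w≡ Q⇔ x = mk⇔
  (λ { (inj₁ s) → from (Q⇔ _) (inj₁ (to (e x) s)) ; (inj₂ refl) → from (Q⇔ _) (inj₂ w≡) })
  (λ q → [ (λ p → inj₁ (from (e x) p)) , (λ x≡ → inj₂ (Finₚ.toℕ-injective (trans x≡ (sym w≡)))) ]′ (to (Q⇔ _) q))

module Construction (m' t b : ℕ) (m≤ : suc m' ≤ t + suc (t + t) * b) where
  open Pattern t
  open Forcing (Γc {2 * suc m'}) Γc?

  m n : ℕ
  m = suc m'
  n = 2 * m

  vertex : ℕ → Fin n
  vertex = clamp

  toℕ-vertex : ∀ {i} → i < n → toℕ (vertex i) ≡ i
  toℕ-vertex = toℕ-clamp _

  -- Kind and forcing time of sink j, numbered from the left end; the
  -- pattern is read from the right end, where the sink number is m − 1 − j.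
  kind : ℕ → Kind
  kind j = kindAt (m ∸ suc j)

  time : ℕ → ℕ
  time j = timeAt (m ∸ suc j)

  rightward-pred : ∀ j → suc j < m → kind (suc j) ≡ rightward →
                   (kind j ≡ seed × time (suc j) ≡ 1) ⊎ (kind j ≡ rightward × time (suc j) ≡ suc (time j))
  rightward-pred j 1+j<m k =
    subst (λ D → (kindAt D ≡ seed × time (suc j) ≡ 1) ⊎ (kindAt D ≡ rightward × time (suc j) ≡ suc (timeAt D)))
          (sym (∸-suc 1+j<m)) (rightward-left (m ∸ suc (suc j)) k)

  leftward-succ : ∀ j → kind j ≡ leftward → suc j < m ×
                  ((kind (suc j) ≡ seed × time j ≡ 1) ⊎ (kind (suc j) ≡ leftward × time j ≡ suc (time (suc j))))
  leftward-succ j k with suc j <? m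
  ... | no 1+j≮m = ⊥-elim (leftward-0 (subst (λ D → kindAt D ≡ leftward) (m≤n⇒m∸n≡0 (≮⇒≥ 1+j≮m)) k))
  ... | yes 1+j<m = 1+j<m ,
    subst (λ D → (kind (suc j) ≡ seed × timeAt D ≡ 1) ⊎ (kind (suc j) ≡ leftward × timeAt D ≡ suc (time (suc j))))
          (sym (∸-suc 1+j<m)) (leftward-right (m ∸ suc (suc j)) (subst (λ D → kindAt D ≡ leftward) (∸-suc 1+j<m) k))

  initial : ℕ → Bool
  initial = withSources (λ j → isSeed (kind j))

  B : Subset n
  B = tabulate (λ x → initial (toℕ x))

  ∈B⇔ : ∀ x → (x ∈ₛ B) ⇔ (initial (toℕ x) ≡ true)
  ∈B⇔ x = mk⇔ (λ x∈B → trans (sym (lookup∘tabulate (λ x → initial (toℕ x)) x)) ([]=⇒lookup x∈B))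
              (λ init → lookup⇒[]= x B (trans (lookup∘tabulate (λ x → initial (toℕ x)) x) init))

  source sink : ℕ → Fin n
  source j = vertex (j + j)
  sink j = vertex (suc (j + j))

  toℕ-source : ∀ {j} → j < m → toℕ (source j) ≡ j + j
  toℕ-source j<m = toℕ-vertex (even<double j<m)

  toℕ-sink : ∀ {j} → j < m → toℕ (sink j) ≡ suc (j + j)
  toℕ-sink j<m = toℕ-vertex (odd<double j<m)

  sink-injective : ∀ a b → suc (a + a) ≡ suc (b + b) → a ≡ b
  sink-injective a b e = double-injective a b (suc-injective e)

  leftForce rightForce : ℕ → Fin n × Fin n
  leftForce j = source (suc j) , sink j
  rightForce j = source j , sink j

  addLeft addRight : Kind → ℕ → List (Fin n × Fin n) → List (Fin n × Fin n)
  addLeft leftward j ℓ = leftForce j ∷ ℓ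
  addLeft seed j ℓ = ℓ
  addLeft rightward j ℓ = ℓ
  addRight rightward j ℓ = rightForce j ∷ ℓ
  addRight seed j ℓ = ℓ
  addRight leftward j ℓ = ℓ

  -- Phase 1: the leftward forces of the sinks j < p, from right to left.
  leftPhase : ℕ → List (Fin n × Fin n)
  leftPhase zero = []
  leftPhase (suc p) = addLeft (kind p) p (leftPhase p)

  -- Phase 2: the rightward forces of the sinks p, …, p + c − 1, from left to right.
  rightPhase : ℕ → ℕ → List (Fin n × Fin n)
  rightPhase p zero = []
  rightPhase p (suc c) = addRight (kind p) p (rightPhase (suc p) c)

  forces : List (Fin n × Fin n)
  forces = leftPhase m ++ rightPhase 0 m

  -- Blue during phase 1, once the leftward sinks j ≥ p have been forced.
  Blue₁ : ℕ → ℕ → Set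
  Blue₁ p i = initial i ≡ true ⊎ Σ ℕ λ j → i ≡ suc (j + j) × p ≤ j × kind j ≡ leftward

  -- Blue during phase 2, once all leftward sinks and the rightward sinks
  -- j < p have been forced.
  Blue₂ : ℕ → ℕ → Set
  Blue₂ p i = initial i ≡ true ⊎ Σ ℕ λ j → i ≡ suc (j + j) × (kind j ≡ leftward ⊎ (kind j ≡ rightward × j < p))

  initial-source : ∀ j → initial (j + j) ≡ true
  initial-source = withSources-even _

  initial-sink : ∀ j → initial (suc (j + j)) ≡ isSeed (kind j)
  initial-sink = withSources-odd _

  not-initial : ∀ {j} → isSeed (kind j) ≡ false → initial (suc (j + j)) ≢ true
  not-initial {j} non-seed init with trans (sym non-seed) (trans (sym (initial-sink j)) init)
  ... | ()

  Blue₁-force : ∀ p → kind p ≡ leftward → ∀ i → Blue₁ p i ⇔ (Blue₁ (suc p) i ⊎ i ≡ suc (p + p))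
  Blue₁-force p kp i = mk⇔ forward backward
    where
    forward : Blue₁ p i → Blue₁ (suc p) i ⊎ i ≡ suc (p + p)
    forward (inj₁ init) = inj₁ (inj₁ init)
    forward (inj₂ (j , i≡ , p≤j , kj)) with m≤n⇒m<n∨m≡n p≤j
    ... | inj₁ p<j = inj₁ (inj₂ (j , i≡ , p<j , kj))
    ... | inj₂ refl = inj₂ i≡
    backward : Blue₁ (suc p) i ⊎ i ≡ suc (p + p) → Blue₁ p i
    backward (inj₁ (inj₁ init)) = inj₁ init
    backward (inj₁ (inj₂ (j , i≡ , p<j , kj))) = inj₂ (j , i≡ , <⇒≤ p<j , kj)
    backward (inj₂ i≡) = inj₂ (p , i≡ , ≤-refl , kp)

  Blue₁-skip : ∀ p → kind p ≢ leftward → ∀ i → Blue₁ (suc p) i ⇔ Blue₁ p i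
  Blue₁-skip p kp i = mk⇔ forward backward
    where
    forward : Blue₁ (suc p) i → Blue₁ p i
    forward (inj₁ init) = inj₁ init
    forward (inj₂ (j , i≡ , p<j , kj)) = inj₂ (j , i≡ , <⇒≤ p<j , kj)
    backward : Blue₁ p i → Blue₁ (suc p) i
    backward (inj₁ init) = inj₁ init
    backward (inj₂ (j , i≡ , p≤j , kj)) with m≤n⇒m<n∨m≡n p≤j
    ... | inj₁ p<j = inj₂ (j , i≡ , p<j , kj)
    ... | inj₂ refl = ⊥-elim (kp kj)

  -- The leftward force of sink p is valid in phase 1: its source is blue,
  -- the sink is white, and the other neighbour, sink p+1, is a seed or an
  -- already forced leftward sink.
  leftForce-valid : ∀ p → kind p ≡ leftward → ∀ {S} → Describes (Blue₁ (suc p)) S →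
                    CanForce Γc S (source (suc p)) (sink p)
  leftForce-valid p kp {S} e = canForce-intro (from (e u) u-blue) (λ s → w-white (to (e w) s)) (u-even , inj₂ u≡1+w) others
    where
    u w : Fin n
    u = source (suc p)
    w = sink p
    1+p<m : suc p < m
    1+p<m = proj₁ (leftward-succ p kp)
    u≡ : toℕ u ≡ suc (suc (p + p))
    u≡ = trans (toℕ-source 1+p<m) (suc+suc p)
    w≡ : toℕ w ≡ suc (p + p)
    w≡ = toℕ-sink (<⇒≤ 1+p<m)
    u≡1+w : toℕ u ≡ suc (toℕ w)
    u≡1+w = trans u≡ (cong suc (sym w≡))
    u-even : odd (toℕ u) ≡ false
    u-even = trans (cong odd (toℕ-source 1+p<m)) (odd-double (suc p))
    u-blue : Blue₁ (suc p) (toℕ u)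
    u-blue = inj₁ (trans (cong initial (toℕ-source 1+p<m)) (initial-source (suc p)))
    w-white : ¬ Blue₁ (suc p) (toℕ w)
    w-white (inj₁ init) = not-initial {p} (cong isSeed kp) (trans (cong initial (sym w≡)) init)
    w-white (inj₂ (j , w≡j , 1+p≤j , _)) with sink-injective p j (trans (sym w≡) w≡j)
    ... | refl = <-irrefl refl 1+p≤j
    next-blue : Blue₁ (suc p) (suc (suc p + suc p))
    next-blue with proj₂ (leftward-succ p kp)
    ... | inj₁ (seed-next , _) = inj₁ (trans (initial-sink (suc p)) (cong isSeed seed-next))
    ... | inj₂ (leftward-next , _) = inj₂ (suc p , refl , ≤-refl , leftward-next)
    others : ∀ v → Γc u v → toℕ v ≢ toℕ w → S v
    others v (_ , inj₁ v≡1+u) _ = from (e v) (subst (Blue₁ (suc p)) (sym (trans v≡1+u (cong suc (trans u≡ (sym (suc+suc p)))))) next-blue)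
    others v (_ , inj₂ u≡1+v) v≢w = ⊥-elim (v≢w (suc-injective (trans (sym u≡1+v) u≡1+w)))

  leftPhase-valid : ∀ p {S} → Describes (Blue₁ p) S → ∀ rest →
                    (∀ {S'} → Describes (Blue₁ 0) S' → ValidFrom Γc S' rest) → ValidFrom Γc S (leftPhase p ++ rest)
  leftPhase-valid zero e rest continue = continue e
  leftPhase-valid (suc p) e rest continue with kind p in kp
  ... | leftward = leftForce-valid p kp e ,
                   leftPhase-valid p (describes-add e (toℕ-sink (<⇒≤ (proj₁ (leftward-succ p kp)))) (Blue₁-force p kp)) rest continue
  ... | seed = leftPhase-valid p (describes-⇔ (Blue₁-skip p (λ k → seed≢leftward (trans (sym kp) k))) e) rest continue
  ... | rightward = leftPhase-valid p (describes-⇔ (Blue₁-skip p (λ k → leftward≢rightward (trans (sym k) kp))) e) rest continue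

  Blue₂-weaken : ∀ p i → Blue₂ p i → Blue₂ (suc p) i
  Blue₂-weaken p i (inj₁ init) = inj₁ init
  Blue₂-weaken p i (inj₂ (j , i≡ , inj₁ kl)) = inj₂ (j , i≡ , inj₁ kl)
  Blue₂-weaken p i (inj₂ (j , i≡ , inj₂ (kr , j<p))) = inj₂ (j , i≡ , inj₂ (kr , m≤n⇒m≤1+n j<p))

  Blue₂-force : ∀ p → kind p ≡ rightward → ∀ i → Blue₂ (suc p) i ⇔ (Blue₂ p i ⊎ i ≡ suc (p + p))
  Blue₂-force p kp i = mk⇔ forward [ Blue₂-weaken p i , (λ i≡ → inj₂ (p , i≡ , inj₂ (kp , ≤-refl))) ]′
    where
    forward : Blue₂ (suc p) i → Blue₂ p i ⊎ i ≡ suc (p + p)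
    forward (inj₁ init) = inj₁ (inj₁ init)
    forward (inj₂ (j , i≡ , inj₁ kl)) = inj₁ (inj₂ (j , i≡ , inj₁ kl))
    forward (inj₂ (j , i≡ , inj₂ (kr , j<1+p))) with m≤n⇒m<n∨m≡n (≤-pred j<1+p)
    ... | inj₁ j<p = inj₁ (inj₂ (j , i≡ , inj₂ (kr , j<p)))
    ... | inj₂ refl = inj₂ i≡

  Blue₂-skip : ∀ p → kind p ≢ rightward → ∀ i → Blue₂ p i ⇔ Blue₂ (suc p) i
  Blue₂-skip p kp i = mk⇔ (Blue₂-weaken p i) backward
    where
    backward : Blue₂ (suc p) i → Blue₂ p i
    backward (inj₁ init) = inj₁ init
    backward (inj₂ (j , i≡ , inj₁ kl)) = inj₂ (j , i≡ , inj₁ kl)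
    backward (inj₂ (j , i≡ , inj₂ (kr , j<1+p))) with m≤n⇒m<n∨m≡n (≤-pred j<1+p)
    ... | inj₁ j<p = inj₂ (j , i≡ , inj₂ (kr , j<p))
    ... | inj₂ refl = ⊥-elim (kp kr)

  sink-Blue₂ : ∀ p j → (kind j ≡ rightward → j < p) → Blue₂ p (suc (j + j))
  sink-Blue₂ p j reached with kind j in kj
  ... | seed = inj₁ (trans (initial-sink j) (cong isSeed kj))
  ... | leftward = inj₂ (j , refl , inj₁ kj)
  ... | rightward = inj₂ (j , refl , inj₂ (kj , reached refl))

  -- The rightward force of sink p is valid in phase 2: its source is blue,
  -- the sink is white, and the other neighbour (sink p − 1, if any) is blue.
  rightForce-valid : ∀ p → p < m → kind p ≡ rightward → ∀ {S} → Describes (Blue₂ p) S →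
                     CanForce Γc S (source p) (sink p)
  rightForce-valid p p<m kp {S} e = canForce-intro (from (e u) u-blue) (λ s → w-white (to (e w) s)) (u-even , inj₁ w≡1+u) others
    where
    u w : Fin n
    u = source p
    w = sink p
    w≡1+u : toℕ w ≡ suc (toℕ u)
    w≡1+u = trans (toℕ-sink p<m) (cong suc (sym (toℕ-source p<m)))
    u-even : odd (toℕ u) ≡ false
    u-even = trans (cong odd (toℕ-source p<m)) (odd-double p)
    u-blue : Blue₂ p (toℕ u)
    u-blue = inj₁ (trans (cong initial (toℕ-source p<m)) (initial-source p))
    w-white : ¬ Blue₂ p (toℕ w)
    w-white (inj₁ init) = not-initial {p} (cong isSeed kp) (trans (cong initial (sym (toℕ-sink p<m))) init)
    w-white (inj₂ (j , w≡j , kind-j)) with sink-injective p j (trans (sym (toℕ-sink p<m)) w≡j) | kind-j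
    ... | refl | inj₁ kl = leftward≢rightward (trans (sym kl) kp)
    ... | refl | inj₂ (_ , p<p) = <-irrefl refl p<p
    left-neighbour : ∀ p i → p + p ≡ suc i → Blue₂ p i
    left-neighbour (suc p₀) i e = subst (Blue₂ (suc p₀)) (trans (sym (+-suc p₀ p₀)) (suc-injective e))
                                    (sink-Blue₂ (suc p₀) p₀ (λ _ → ≤-refl))
    others : ∀ v → Γc u v → toℕ v ≢ toℕ w → S v
    others v (_ , inj₁ v≡1+u) v≢w = ⊥-elim (v≢w (trans v≡1+u (sym w≡1+u)))
    others v (_ , inj₂ u≡1+v) _ = from (e v) (left-neighbour p (toℕ v) (trans (sym (toℕ-source p<m)) u≡1+v))

  rightPhase-valid : ∀ c p → p + c ≡ m → ∀ {S} → Describes (Blue₂ p) S → ValidFrom Γc S (rightPhase p c)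
  rightPhase-valid zero p p+0≡m e u w (_ , w-white , _) = w-white (from (e w) all-blue)
    where
    all-blue : Blue₂ p (toℕ w)
    all-blue with halve (toℕ w)
    ... | j , inj₁ w≡ = inj₁ (trans (cong initial w≡) (initial-source j))
    ... | j , inj₂ w≡ = subst (Blue₂ p) (sym w≡)
                          (sink-Blue₂ p j (λ _ → subst (j <_) (trans (sym p+0≡m) (+-identityʳ p)) (sink-index< w w≡)))
  rightPhase-valid (suc c) p p+1+c≡m e with kind p in kp
  ... | rightward = rightForce-valid p p<m kp e ,
                    rightPhase-valid c (suc p) (trans (sym (+-suc p c)) p+1+c≡m) (describes-add e (toℕ-sink p<m) (Blue₂-force p kp))
    where
    p<m : p < m
    p<m = ≤-trans (s≤s (m≤m+n p c)) (≤-reflexive (trans (sym (+-suc p c)) p+1+c≡m))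
  ... | seed = rightPhase-valid c (suc p) (trans (sym (+-suc p c)) p+1+c≡m)
                 (describes-⇔ (Blue₂-skip p (λ k → seed≢rightward (trans (sym kp) k))) e)
  ... | leftward = rightPhase-valid c (suc p) (trans (sym (+-suc p c)) p+1+c≡m)
                     (describes-⇔ (Blue₂-skip p (λ k → leftward≢rightward (trans (sym kp) k))) e)

  forces-valid : IsForceOrderOf Γc B forces
  forces-valid = leftPhase-valid m start (rightPhase 0 m)
                   (λ e → rightPhase-valid m 0 refl (describes-⇔ Blue₁0⇔Blue₂0 e))
    where
    start : Describes (Blue₁ m) (λ x → x ∈ₛ B)
    start x = mk⇔ (λ x∈B → inj₁ (to (∈B⇔ x) x∈B)) blue⇒∈B
      where
      blue⇒∈B : Blue₁ m (toℕ x) → x ∈ₛ B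
      blue⇒∈B (inj₁ init) = from (∈B⇔ x) init
      blue⇒∈B (inj₂ (j , x≡ , m≤j , _)) = ⊥-elim (<⇒≱ (sink-index< x x≡) m≤j)
    Blue₁0⇔Blue₂0 : ∀ i → Blue₁ 0 i ⇔ Blue₂ 0 i
    Blue₁0⇔Blue₂0 i = mk⇔ (λ { (inj₁ init) → inj₁ init ; (inj₂ (j , i≡ , _ , kl)) → inj₂ (j , i≡ , inj₁ kl) })
                          (λ { (inj₁ init) → inj₁ init ; (inj₂ (j , i≡ , inj₁ kl)) → inj₂ (j , i≡ , z≤n , kl) })

  leftForce∈ : ∀ p j → j < p → kind j ≡ leftward → leftForce j ∈ leftPhase p
  leftForce∈ (suc p) j j<1+p kj with m≤n⇒m<n∨m≡n (≤-pred j<1+p)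
  ... | inj₁ j<p = later (kind p) (leftForce∈ p j j<p kj)
    where
    later : ∀ k → leftForce j ∈ leftPhase p → leftForce j ∈ addLeft k p (leftPhase p)
    later seed x∈ = x∈
    later leftward x∈ = there x∈
    later rightward x∈ = x∈
  ... | inj₂ refl rewrite kj = here refl

  rightForce∈ : ∀ c p j → p ≤ j → j < p + c → kind j ≡ rightward → rightForce j ∈ rightPhase p c
  rightForce∈ zero p j p≤j j<p+0 _ = ⊥-elim (<⇒≱ (≤-trans j<p+0 (≤-reflexive (+-identityʳ p))) p≤j)
  rightForce∈ (suc c) p j p≤j j<p+1+c kj with m≤n⇒m<n∨m≡n p≤j
  ... | inj₁ p<j = later (kind p) (rightForce∈ c (suc p) j p<j (≤-trans j<p+1+c (≤-reflexive (+-suc p c))) kj)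
    where
    later : ∀ k → rightForce j ∈ rightPhase (suc p) c → rightForce j ∈ addRight k p (rightPhase (suc p) c)
    later seed x∈ = x∈
    later leftward x∈ = x∈
    later rightward x∈ = there x∈
  ... | inj₂ refl rewrite kj = here refl

  St : ℕ → VSet n
  St = Stage Γc B forces

  initial-blue : ∀ s x → initial (toℕ x) ≡ true → St s x
  initial-blue s x init = stage-mono z≤n (from (∈B⇔ x) init)

  source-blue : ∀ s j → j < m → St s (source j)
  source-blue s j j<m = initial-blue s _ (trans (cong initial (toℕ-source j<m)) (initial-source j))

  rightward-step : ∀ j s → j < m → kind j ≡ rightward →
                   (∀ v → toℕ (source j) ≡ suc (toℕ v) → St s v) → St (suc s) (sink j)
  rightward-step j s j<m kj left =
    stage-force (∈-++⁺ʳ (leftPhase m) (rightForce∈ m 0 j z≤n j<m kj)) (u-even , inj₁ w≡1+u) (source-blue s j j<m) others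
    where
    w≡1+u : toℕ (sink j) ≡ suc (toℕ (source j))
    w≡1+u = trans (toℕ-sink j<m) (cong suc (sym (toℕ-source j<m)))
    u-even : odd (toℕ (source j)) ≡ false
    u-even = trans (cong odd (toℕ-source j<m)) (odd-double j)
    others : ∀ v → Γc (source j) v → toℕ v ≢ toℕ (sink j) → St s v
    others v (_ , inj₁ v≡1+u) v≢w = ⊥-elim (v≢w (trans v≡1+u (sym w≡1+u)))
    others v (_ , inj₂ u≡1+v) _ = left v u≡1+v

  leftward-step : ∀ j s → suc j < m → kind j ≡ leftward →
                  (∀ v → toℕ v ≡ suc (toℕ (source (suc j))) → St s v) → St (suc s) (sink j)
  leftward-step j s 1+j<m kj right =
    stage-force (∈-++⁺ˡ (leftForce∈ m j (<⇒≤ 1+j<m) kj)) (u-even , inj₂ u≡1+w) (source-blue s (suc j) 1+j<m) others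
    where
    u≡1+w : toℕ (source (suc j)) ≡ suc (toℕ (sink j))
    u≡1+w = trans (toℕ-source 1+j<m) (trans (suc+suc j) (cong suc (sym (toℕ-sink (<⇒≤ 1+j<m)))))
    u-even : odd (toℕ (source (suc j))) ≡ false
    u-even = trans (cong odd (toℕ-source 1+j<m)) (odd-double (suc j))
    others : ∀ v → Γc (source (suc j)) v → toℕ v ≢ toℕ (sink j) → St s v
    others v (_ , inj₁ v≡1+u) _ = right v v≡1+u
    others v (_ , inj₂ u≡1+v) v≢w = ⊥-elim (v≢w (suc-injective (trans (sym u≡1+v) u≡1+w)))

  left-of-source : ∀ {j} v → suc j < m → toℕ (source (suc j)) ≡ suc (toℕ v) → v ≡ sink j
  left-of-source {j} v 1+j<m e = Finₚ.toℕ-injective (suc-injective (trans (sym e)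
    (trans (toℕ-source 1+j<m) (trans (suc+suc j) (cong suc (sym (toℕ-sink (<⇒≤ 1+j<m))))))))

  right-of-source : ∀ {j} v → suc j < m → toℕ v ≡ suc (toℕ (source (suc j))) → v ≡ sink (suc j)
  right-of-source {j} v 1+j<m e = Finₚ.toℕ-injective (trans e (trans (cong suc (toℕ-source 1+j<m)) (sym (toℕ-sink 1+j<m))))

  -- Rightward sink j is blue at its time: follow the chain to the left,
  -- which ends at a seed or at the left end of the path.
  rightward-blue : ∀ j → j < m → kind j ≡ rightward → St (time j) (sink j)
  rightward-blue zero 0<m k with m≤n⇒∃[o]m+o≡n (rightward-time>0 (m ∸ 1) k)
  ... | s , 1+s≡time = subst (λ z → St z (sink 0)) 1+s≡time
        (rightward-step 0 s 0<m k (λ v e → ⊥-elim (0≢1+n (trans (sym (toℕ-source 0<m)) e))))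
  rightward-blue (suc j) 1+j<m k with rightward-pred j 1+j<m k
  ... | inj₁ (seed-j , time≡1) = subst (λ z → St z (sink (suc j))) (sym time≡1)
        (rightward-step (suc j) 0 1+j<m k (λ v e → subst (St 0) (sym (left-of-source v 1+j<m e))
          (initial-blue 0 _ (trans (cong initial (toℕ-sink (<⇒≤ 1+j<m))) (trans (initial-sink j) (cong isSeed seed-j))))))
  ... | inj₂ (rightward-j , time≡) = subst (λ z → St z (sink (suc j))) (sym time≡)
        (rightward-step (suc j) (time j) 1+j<m k (λ v e → subst (St (time j)) (sym (left-of-source v 1+j<m e))
          (rightward-blue j (<⇒≤ 1+j<m) rightward-j)))

  -- Leftward sink j is blue at its time: follow the chain to the right,
  -- which ends at a seed (recursion on the sink number D = m − 1 − j).
  leftward-blue : ∀ D j → m ∸ suc j ≡ D → kind j ≡ leftward → St (time j) (sink j)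
  leftward-blue zero j D≡ k = ⊥-elim (leftward-0 (subst (λ D → kindAt D ≡ leftward) D≡ k))
  leftward-blue (suc D) j D≡ k with leftward-succ j k
  ... | 1+j<m , inj₁ (seed-next , time≡1) = subst (λ z → St z (sink j)) (sym time≡1)
        (leftward-step j 0 1+j<m k (λ v e → subst (St 0) (sym (right-of-source v 1+j<m e))
          (initial-blue 0 _ (trans (cong initial (toℕ-sink 1+j<m)) (trans (initial-sink (suc j)) (cong isSeed seed-next))))))
  ... | 1+j<m , inj₂ (leftward-next , time≡) = subst (λ z → St z (sink j)) (sym time≡)
        (leftward-step j (time (suc j)) 1+j<m k (λ v e → subst (St (time (suc j))) (sym (right-of-source v 1+j<m e))
          (leftward-blue D (suc j) (suc-injective (trans (sym (∸-suc 1+j<m)) D≡)) leftward-next)))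

  all-blue : AllBlueAt Γc B forces t
  all-blue x with halve (toℕ x)
  ... | j , inj₁ x≡ = initial-blue t x (trans (cong initial x≡) (initial-source j))
  ... | j , inj₂ x≡ = subst (St t) (sym x≡sink) (sink-blue (kind j) refl)
    where
    j<m : j < m
    j<m = sink-index< x x≡
    x≡sink : x ≡ sink j
    x≡sink = Finₚ.toℕ-injective (trans x≡ (sym (toℕ-sink j<m)))
    sink-blue : ∀ k → kind j ≡ k → St t (sink j)
    sink-blue seed kj = initial-blue t _ (trans (cong initial (toℕ-sink j<m)) (trans (initial-sink j) (cong isSeed kj)))
    sink-blue leftward kj = stage-mono (timeAt≤t (m ∸ suc j)) (leftward-blue _ j refl kj)
    sink-blue rightward kj = stage-mono (timeAt≤t (m ∸ suc j)) (rightward-blue j j<m kj)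

  -- B consists of the m sources and at most b seeds.
  ∣B∣≤ : ∣ B ∣ ≤ m + b
  ∣B∣≤ = begin
      ∣ B ∣
    ≡⟨ ∣∣-tabulate n initial ⟩
      countBelow initial (2 * m)
    ≡⟨ cong (countBelow initial) (2*≡+ m) ⟩
      countBelow initial (m + m)
    ≡⟨ countBelow-evenOdd m initial ⟩
      countBelow (λ j → initial (j + j)) m + countBelow (λ j → initial (suc (j + j))) m
    ≡⟨ cong₂ _+_ (countBelow-ones m _ (λ j _ → initial-source j)) (countBelow-ext m _ _ (λ j _ → initial-sink j)) ⟩
      m + countBelow (λ j → isSeed (kindAt (m ∸ suc j))) m
    ≡⟨ cong (m +_) (sym (countBelow-reverse m (λ D → isSeed (kindAt D)))) ⟩
      m + countBelow (λ D → isSeed (kindAt D)) m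
    ≤⟨ +-monoʳ-≤ m (seeds≤ m b m≤) ⟩
      m + b
    ∎
    where open ≤-Reasoning

canonical-throttling : ∀ m' k → IsCeilSqrtSucMinusOne (2 * suc m') k → ThrottlingNumberIs (Γc {2 * suc m'}) (suc m' + k)
canonical-throttling m' k (k-fits , k-least) with balancedSplit k
... | t , b , refl , balanced =
  (B , forces , t , forces-valid , all-blue , ≤-antisym upper lower) ,
  λ B' ℓ' t' _ allBlue' → LowerBound.lowerBound m B' ℓ' t' allBlue' (b + t) k-least
  where
  open Construction m' t b (square⇒coverage (suc m') t b balanced k-fits)
  upper : ∣ B ∣ + t ≤ m + (b + t)
  upper = ≤-trans (+-monoˡ-≤ t ∣B∣≤) (≤-reflexive (+-assoc m b t))
  lower : m + (b + t) ≤ ∣ B ∣ + t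
  lower = LowerBound.lowerBound m B forces t all-blue (b + t) k-least

-- 5. Alternating orientations of the path

no-transit : ∀ {n} {Γ : Digraph n} → Alternating Γ → ∀ {a v c} → Γ a v → Γ v c → ⊥
no-transit alt {a} {v} {c} av vc with alt v
... | inj₁ source = source a av
... | inj₂ sink = sink c vc

module Vertices (n i : ℕ) (i+2<n : suc (suc i) < n) where
  a v c : Fin n
  a = fromℕ< (<-trans (n<1+n i) (<-trans (n<1+n (suc i)) i+2<n))
  v = fromℕ< (<-trans (n<1+n (suc i)) i+2<n)
  c = fromℕ< i+2<n

  a≡ : toℕ a ≡ i
  a≡ = Finₚ.toℕ-fromℕ< _
  v≡ : toℕ v ≡ suc i
  v≡ = Finₚ.toℕ-fromℕ< _
  v≡1+a : toℕ v ≡ suc (toℕ a)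
  v≡1+a = trans v≡ (cong suc (sym a≡))
  c≡1+v : toℕ c ≡ suc (toℕ v)
  c≡1+v = trans (Finₚ.toℕ-fromℕ< i+2<n) (cong suc (sym v≡))

orientation-flips : ∀ n d → Alternating (PathOrientation n d) → ∀ i → suc (suc i) < n → d (suc i) ≡ not (d i)
orientation-flips n d alt i i+2<n with d i in di | d (suc i) in d1+i
... | true | false = refl
... | false | true = refl
... | true | true = ⊥-elim (no-transit alt {a} {v} {c} (inj₁ (v≡1+a , trans (cong d a≡) di)) (inj₁ (c≡1+v , trans (cong d v≡) d1+i)))
  where open Vertices n i i+2<n
... | false | false = ⊥-elim (no-transit alt {c} {v} {a} (inj₂ (c≡1+v , trans (cong d v≡) d1+i)) (inj₂ (v≡1+a , trans (cong d a≡) di)))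
  where open Vertices n i i+2<n

flips-agree : ∀ n (f g : ℕ → Bool) → f 0 ≡ g 0 →
              (∀ i → suc (suc i) < n → f (suc i) ≡ not (f i)) → (∀ i → suc (suc i) < n → g (suc i) ≡ not (g i)) →
              ∀ i → suc i < n → f i ≡ g i
flips-agree n f g f0≡g0 f-flips g-flips zero _ = f0≡g0
flips-agree n f g f0≡g0 f-flips g-flips (suc i) i+2<n =
  trans (f-flips i i+2<n) (trans (cong not (flips-agree n f g f0≡g0 f-flips g-flips i (<⇒≤ i+2<n))) (sym (g-flips i i+2<n)))

canonical-iso-id : ∀ n d → (∀ i → suc i < n → d i ≡ not (odd i)) → InvolutiveIso Γc (PathOrientation n d)
canonical-iso-id n d d≡ = record { π = λ x → x ; involutive = λ _ → refl ; arcs→ = arcs→ ; arcs← = arcs← }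
  where
  arcs→ : ∀ u v → Γc u v → PathOrientation n d u v
  arcs→ u v (even-u , inj₁ v≡1+u) = inj₁ (v≡1+u , trans (d≡ _ (subst (_< n) v≡1+u (Finₚ.toℕ<n v))) (cong not even-u))
  arcs→ u v (even-u , inj₂ u≡1+v) = inj₂ (u≡1+v , trans (d≡ _ (subst (_< n) u≡1+v (Finₚ.toℕ<n u))) (cong not odd-v))
    where
    odd-v : odd (toℕ v) ≡ true
    odd-v = not-injective (trans (sym (cong odd u≡1+v)) even-u)
  arcs← : ∀ u v → PathOrientation n d u v → Γc u v
  arcs← u v (inj₁ (v≡1+u , du)) = not-injective (trans (sym (d≡ _ (subst (_< n) v≡1+u (Finₚ.toℕ<n v)))) du) , inj₁ v≡1+u
  arcs← u v (inj₂ (u≡1+v , dv)) = trans (cong odd u≡1+v) (cong not (not-injective (trans (sym (d≡ _ (subst (_< n) u≡1+v (Finₚ.toℕ<n u)))) dv))) , inj₂ u≡1+v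

odd-opposite : ∀ {n} → odd n ≡ false → (x : Fin n) → odd (toℕ (opposite x)) ≡ not (odd (toℕ x))
odd-opposite {n} even-n x = trans (cong odd (Finₚ.opposite-prop x)) (xor-false (begin
    odd (n ∸ suc (toℕ x)) xor odd (suc (toℕ x))
  ≡⟨ sym (odd-+ (n ∸ suc (toℕ x)) (suc (toℕ x))) ⟩
    odd (n ∸ suc (toℕ x) + suc (toℕ x))
  ≡⟨ cong odd (m∸n+n≡m (Finₚ.toℕ<n x)) ⟩
    odd n
  ≡⟨ even-n ⟩
    false
  ∎))
  where
  open ≡-Reasoning
  xor-false : ∀ {a b} → a xor b ≡ false → a ≡ b
  xor-false {false} {false} _ = refl
  xor-false {true} {true} _ = refl

opposite-adjacent : ∀ {n} (a b : Fin n) → toℕ b ≡ suc (toℕ a) → toℕ (opposite a) ≡ suc (toℕ (opposite b))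
opposite-adjacent {n} a b b≡1+a = begin
    toℕ (opposite a)
  ≡⟨ Finₚ.opposite-prop a ⟩
    n ∸ suc (toℕ a)
  ≡⟨ ∸-suc (subst (_< n) b≡1+a (Finₚ.toℕ<n b)) ⟩
    suc (n ∸ suc (suc (toℕ a)))
  ≡⟨ cong (λ i → suc (n ∸ suc i)) (sym b≡1+a) ⟩
    suc (n ∸ suc (toℕ b))
  ≡⟨ cong suc (sym (Finₚ.opposite-prop b)) ⟩
    suc (toℕ (opposite b))
  ∎
  where open ≡-Reasoning

canonical-iso-reverse : ∀ n d → odd n ≡ false → (∀ i → suc i < n → d i ≡ odd i) → InvolutiveIso Γc (PathOrientation n d)
canonical-iso-reverse n d even-n d≡ =
  record { π = opposite ; involutive = Finₚ.opposite-involutive ; arcs→ = arcs→ ; arcs← = arcs← }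
  where
  flip : ∀ x → odd (toℕ (opposite x)) ≡ not (odd (toℕ x))
  flip = odd-opposite even-n
  d-at : ∀ (x y : Fin n) → toℕ y ≡ suc (toℕ x) → d (toℕ x) ≡ odd (toℕ x)
  d-at x y y≡1+x = d≡ _ (subst (_< n) y≡1+x (Finₚ.toℕ<n y))
  arcs→ : ∀ u v → Γc u v → PathOrientation n d (opposite u) (opposite v)
  arcs→ u v (even-u , inj₁ v≡1+u) =
    inj₂ (opposite-adjacent u v v≡1+u ,
          trans (d-at _ _ (opposite-adjacent u v v≡1+u)) (trans (flip v) (cong not (trans (cong odd v≡1+u) (cong not even-u)))))
  arcs→ u v (even-u , inj₂ u≡1+v) =
    inj₁ (opposite-adjacent v u u≡1+v , trans (d-at _ _ (opposite-adjacent v u u≡1+v)) (trans (flip u) (cong not even-u)))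
  arcs← : ∀ u v → PathOrientation n d u v → Γc (opposite u) (opposite v)
  arcs← u v (inj₁ (v≡1+u , du)) =
    trans (flip u) (cong not (trans (sym (d-at u v v≡1+u)) du)) , inj₂ (opposite-adjacent u v v≡1+u)
  arcs← u v (inj₂ (u≡1+v , dv)) =
    trans (flip u) (cong not (trans (cong odd u≡1+v) (cong not (trans (sym (d-at v u u≡1+v)) dv)))) ,
    inj₁ (opposite-adjacent v u u≡1+v)

-- Every alternating orientation of a path with an even number of
-- vertices has the throttling number of Γc: it is Γc or its reversal,
-- according to the direction of the first edge.
alternating-throttling : ∀ n d → odd n ≡ false → Alternating (PathOrientation n d) →
                         ∀ K → ThrottlingNumberIs Γc K → ThrottlingNumberIs (PathOrientation n d) K
alternating-throttling n d even-n alt K th with d 0 in d0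
... | true = throttling-iso (canonical-iso-id n d agree) (λ B → cong ∣_∣ (tabulate∘lookup B)) K th
  where
  agree : ∀ i → suc i < n → d i ≡ not (odd i)
  agree = flips-agree n d (λ i → not (odd i)) d0 (orientation-flips n d alt) (λ _ _ → refl)
... | false = throttling-iso (canonical-iso-reverse n d even-n agree) ∣∣-reverse K th
  where
  agree : ∀ i → suc i < n → d i ≡ odd i
  agree = flips-agree n d odd d0 (orientation-flips n d alt) (λ _ _ → refl)

theorem4p9 : (n m : ℕ) → 0 < n → n ≡ 2 * m →
    (d : ℕ → Bool) → Alternating (PathOrientation n d) →
    (k : ℕ) → IsCeilSqrtSucMinusOne n k →
    ThrottlingNumberIs (PathOrientation n d) (m + k)
theorem4p9 .(2 * zero) zero () refl d alt k k-ceil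
theorem4p9 .(2 * suc m') (suc m') _ refl d alt k k-ceil =
  alternating-throttling (2 * suc m') d even alt (suc m' + k) (canonical-throttling m' k k-ceil)
  where
  even : odd (2 * suc m') ≡ false
  even = trans (cong odd (2*≡+ (suc m'))) (odd-double (suc m'))
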